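{- For all positive integers $r,s$, the number $cw(r,s)$ of weak compositions of $r$ having exactly $s$ parts equal to zero satisfies $$cw(r,s)=\binom{s+1,\,r-1}{s,\,2}.$$
   Context: A weak composition of $r$ is a finite sequence of nonnegative integers whose sum is $r$; $cw(r,s)$ counts those with exactly $s$ entries equal to $0$. For nonnegative integers $m,n$ and a positive integer $q$, let $X$ be a set which is the disjoint union of $n$ "main blocks" each of size $q$ and an "additional block" of size $m$. An $(n+k)$-inset of $X$ is an $(n+k)$-element subset of $X$ that intersects every main block; their number is denoted $\binom{m,n}{k,q}$ (for $n=0$ this is the ordinary binomial coefficient $\binom{m}{k}$). -}

module Defs where

open import Data.Bool using (Bool; true; false; T; _∧_; _∨_)
open import Data.Nat using (ℕ; zero; suc; _+_; _≡ᵇ_)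
open import Data.List using (List; []; _∷_; map; concatMap; length; filterᵇ; cartesianProduct)
open import Data.Nat.ListAction using (sum)
open import Data.Vec using (Vec; []; _∷_)
open import Data.Product using (Σ; _×_; _,_)
open import Relation.Binary.PropositionalEquality using (_≡_)
open import Data.Fin using (Fin)
open import Function.Bundles using (_⤖_)

zeros : List ℕ → ℕ
zeros []            = 0
zeros (zero  ∷ xs)  = suc (zeros xs)
zeros (suc _ ∷ xs)  = zeros xs

WeakComp : ℕ → ℕ → Set
WeakComp r s = Σ (List ℕ) (λ l → (sum l ≡ r) × (zeros l ≡ s))

HasCard : Set → ℕ → Set
HasCard A c = A ⤖ Fin c

-- Insets
-- X = (n main blocks of size q) ⊎ (additional block of size m).
-- A subset of X is encoded by its characteristic vectors:
-- one Vec Bool q per main block, and one Vec Bool m for the additional block.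

allVecs : {A : Set} → List A → (n : ℕ) → List (Vec A n)
allVecs xs zero    = [] ∷ []
allVecs xs (suc n) = concatMap (λ x → map (x ∷_) (allVecs xs n)) xs

allBools : List Bool
allBools = false ∷ true ∷ []

trues : {n : ℕ} → Vec Bool n → ℕ
trues []           = 0
trues (true  ∷ v)  = suc (trues v)
trues (false ∷ v)  = trues v

anyTrue : {n : ℕ} → Vec Bool n → Bool
anyTrue []       = false
anyTrue (b ∷ v)  = b ∨ anyTrue v

truesBlocks : {n q : ℕ} → Vec (Vec Bool q) n → ℕ
truesBlocks []       = 0
truesBlocks (b ∷ bs) = trues b + truesBlocks bs

allMet : {n q : ℕ} → Vec (Vec Bool q) n → Bool
allMet []       = true
allMet (b ∷ bs) = anyTrue b ∧ allMet bs

isInset : (m n k q : ℕ) → Vec (Vec Bool q) n × Vec Bool m → Bool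
isInset m n k q (bs , a) = ((truesBlocks bs + trues a) ≡ᵇ (n + k)) ∧ allMet bs

allSubsetsX : (m n q : ℕ) → List (Vec (Vec Bool q) n × Vec Bool m)
allSubsetsX m n q = cartesianProduct (allVecs (allVecs allBools q) n) (allVecs allBools m)

-- the number  (m,n over k,q)  of (n+k)-insets of X
insetNum : (m n k q : ℕ) → ℕ
insetNum m n k q = length (filterᵇ (isInset m n k q) (allSubsetsX m n q))

-- Both numbers satisfy f(0, s) = s + 1, f(n + 1, 0) = 2 f(n, 0) and
--   f(n + 1, s + 1) + f(n, s) = 2 f(n, s + 1) + f(n + 1, s),
-- with f(n, s) = cw(n + 1, s) and f(n, s) = (s+1, n over s, 2) respectively, and
-- these equations determine f.  For weak compositions the recurrence comes from
-- splitting off the first entry (zero, or positive and then decremented).  For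
-- insets, splitting off the first main block (met in one of its two elements, or
-- in both) shows that (m, n over k, 2) is the coefficient of x^k in
-- (2 + x)^n (1 + x)^m.  As 2 + x = (1 + x) + 1, this gives
--   (m, n + 1 over k, 2) = (m + 1, n over k, 2) + (m, n over k, 2),
-- from which the recurrence follows.
module Submission where

open import Defs
open import Data.Bool using (Bool; true; false; T; _∧_)
open import Data.Bool.Properties using (T-∧; ∧-identityʳ)
open import Data.Empty using (⊥)
open import Data.Fin using (Fin)
open import Data.Fin.Properties using (+↔⊎; 0↔⊥; 1↔⊤)
open import Data.List using (List; []; _∷_; _++_; map; concatMap; length; filterᵇ; cartesianProduct)
open import Data.List.Properties using (length-++; filter-++; filter-≐; filter-none; map-++; map-∘; cartesianProductWith-distribʳ-++)
open import Data.List.Relation.Unary.All using (universal)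
open import Data.Nat using (ℕ; zero; suc; _+_; _*_; _∸_; _≤_; z≤n; s≤s; _≡ᵇ_)
open import Data.Nat.Combinatorics using (_C_; nCk≡nC[n∸k]; nC1≡n; nCk+nC[k+1]≡[n+1]C[k+1])
open import Data.Nat.ListAction using (sum)
open import Data.Nat.Properties
open import Data.Nat.Tactic.RingSolver using (solve-∀)
open import Data.Product as Product using (Σ; _×_; _,_; proj₂)
open import Data.Sum using (_⊎_; inj₁; inj₂)
open import Data.Sum.Function.Propositional using (_⊎-↔_)
open import Data.Unit using (⊤; tt)
open import Data.Vec using (Vec; []; _∷_)
open import Function using (_∘_)
open import Function.Bundles using (_↔_; mk↔ₛ′; Equivalence)
open import Function.Properties.Inverse using (↔-sym; ↔-trans; ↔⇒⤖)
open import Relation.Binary.PropositionalEquality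
open import Relation.Nullary using (¬_)
open import Relation.Nullary.Decidable using (T?)

private
  variable
    X Y Z W : Set

-- The weak composition (1 + a) ∷ l, stored as a , l.
PositiveHead : ℕ → ℕ → Set
PositiveHead r s = Σ ℕ λ a → Σ (List ℕ) λ l → (suc a + sum l ≡ r) × (zeros l ≡ s)

-- The suc s clause comes first so that cw r (suc s) unfolds for a variable r.
cw  : ℕ → ℕ → ℕ
cw⁺ : ℕ → ℕ → ℕ
cw r       (suc s) = cw r s + cw⁺ r (suc s)
cw zero    zero    = 1
cw (suc r) zero    = cw⁺ (suc r) zero
cw⁺ zero    s = 0
cw⁺ (suc r) s = cw r s + cw⁺ r s

WeakComp-≡ : ∀ {r s} (l : List ℕ) {p p′ : sum l ≡ r} {z z′ : zeros l ≡ s} →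
             _≡_ {A = WeakComp r s} (l , p , z) (l , p′ , z′)
WeakComp-≡ l = cong₂ (λ p z → l , p , z) (≡-irrelevant _ _) (≡-irrelevant _ _)

PositiveHead-≡ : ∀ {r s} (a : ℕ) (l : List ℕ) {p p′ : suc a + sum l ≡ r} {z z′ : zeros l ≡ s} →
                 _≡_ {A = PositiveHead r s} (a , l , p , z) (a , l , p′ , z′)
PositiveHead-≡ a l = cong₂ (λ p z → a , l , p , z) (≡-irrelevant _ _) (≡-irrelevant _ _)

WeakComp[0,0]↔⊤ : WeakComp 0 0 ↔ ⊤
WeakComp[0,0]↔⊤ = mk↔ₛ′ (λ _ → tt) (λ _ → [] , refl , refl) (λ _ → refl) inverse
  where
  inverse : (w : WeakComp 0 0) → ([] , refl , refl) ≡ w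
  inverse ([]        , p  , z) = WeakComp-≡ []
  inverse (zero ∷ l  , p  , ())
  inverse (suc a ∷ l , () , z)

WeakComp[1+r,0]↔PositiveHead : ∀ r → WeakComp (suc r) 0 ↔ PositiveHead (suc r) 0
WeakComp[1+r,0]↔PositiveHead r = mk↔ₛ′ to from (λ _ → refl) from∘to
  where
  to : WeakComp (suc r) 0 → PositiveHead (suc r) 0
  to ([]        , () , z)
  to (zero ∷ l  , p  , ())
  to (suc a ∷ l , p  , z) = a , l , p , z
  from : PositiveHead (suc r) 0 → WeakComp (suc r) 0
  from (a , l , p , z) = suc a ∷ l , p , z
  from∘to : ∀ w → from (to w) ≡ w
  from∘to ([]        , () , z)
  from∘to (zero ∷ l  , p  , ())
  from∘to (suc a ∷ l , p  , z) = refl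

WeakComp[r,1+s]↔WeakComp⊎PositiveHead : ∀ r s → WeakComp r (suc s) ↔ (WeakComp r s ⊎ PositiveHead r (suc s))
WeakComp[r,1+s]↔WeakComp⊎PositiveHead r s = mk↔ₛ′ to from to∘from from∘to
  where
  to : WeakComp r (suc s) → WeakComp r s ⊎ PositiveHead r (suc s)
  to ([]        , p , ())
  to (zero ∷ l  , p , z) = inj₁ (l , p , suc-injective z)
  to (suc a ∷ l , p , z) = inj₂ (a , l , p , z)
  from : WeakComp r s ⊎ PositiveHead r (suc s) → WeakComp r (suc s)
  from (inj₁ (l , p , z))     = zero ∷ l , p , cong suc z
  from (inj₂ (a , l , p , z)) = suc a ∷ l , p , z
  to∘from : ∀ x → to (from x) ≡ x
  to∘from (inj₁ (l , p , z)) = cong inj₁ (WeakComp-≡ l)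
  to∘from (inj₂ _)           = refl
  from∘to : ∀ w → from (to w) ≡ w
  from∘to ([]        , p , ())
  from∘to (zero ∷ l  , p , z) = WeakComp-≡ (zero ∷ l)
  from∘to (suc a ∷ l , p , z) = refl

PositiveHead[0,s]↔⊥ : ∀ s → PositiveHead 0 s ↔ ⊥
PositiveHead[0,s]↔⊥ s = mk↔ₛ′ (λ { (a , l , () , z) }) (λ ()) (λ ()) (λ { (a , l , () , z) })

-- Decrementing the first entry, and dropping it when it becomes 0.
PositiveHead[1+r,s]↔WeakComp⊎PositiveHead : ∀ r s → PositiveHead (suc r) s ↔ (WeakComp r s ⊎ PositiveHead r s)
PositiveHead[1+r,s]↔WeakComp⊎PositiveHead r s = mk↔ₛ′ to from to∘from from∘to
  where
  to : PositiveHead (suc r) s → WeakComp r s ⊎ PositiveHead r s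
  to (zero  , l , p , z) = inj₁ (l , suc-injective p , z)
  to (suc a , l , p , z) = inj₂ (a , l , suc-injective p , z)
  from : WeakComp r s ⊎ PositiveHead r s → PositiveHead (suc r) s
  from (inj₁ (l , p , z))     = zero , l , cong suc p , z
  from (inj₂ (a , l , p , z)) = suc a , l , cong suc p , z
  to∘from : ∀ x → to (from x) ≡ x
  to∘from (inj₁ (l , p , z))     = cong inj₁ (WeakComp-≡ l)
  to∘from (inj₂ (a , l , p , z)) = cong inj₂ (PositiveHead-≡ a l)
  from∘to : ∀ x → from (to x) ≡ x
  from∘to (zero  , l , p , z) = PositiveHead-≡ zero l
  from∘to (suc a , l , p , z) = PositiveHead-≡ (suc a) l

⊎-cardinality : ∀ {A B : Set} {m n} → A ↔ Fin m → B ↔ Fin n → (A ⊎ B) ↔ Fin (m + n)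
⊎-cardinality a b = ↔-trans (a ⊎-↔ b) (↔-sym +↔⊎)

WeakComp-cardinality     : ∀ r s → WeakComp r s ↔ Fin (cw r s)
PositiveHead-cardinality : ∀ r s → PositiveHead r s ↔ Fin (cw⁺ r s)
WeakComp-cardinality zero zero =
  ↔-trans WeakComp[0,0]↔⊤ (↔-sym 1↔⊤)
WeakComp-cardinality (suc r) zero =
  ↔-trans (WeakComp[1+r,0]↔PositiveHead r) (PositiveHead-cardinality (suc r) zero)
WeakComp-cardinality r (suc s) =
  ↔-trans (WeakComp[r,1+s]↔WeakComp⊎PositiveHead r s)
          (⊎-cardinality (WeakComp-cardinality r s) (PositiveHead-cardinality r (suc s)))
PositiveHead-cardinality zero s =
  ↔-trans (PositiveHead[0,s]↔⊥ s) (↔-sym 0↔⊥)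
PositiveHead-cardinality (suc r) s =
  ↔-trans (PositiveHead[1+r,s]↔WeakComp⊎PositiveHead r s)
          (⊎-cardinality (WeakComp-cardinality r s) (PositiveHead-cardinality r s))

cw[0,s]≡1 : ∀ s → cw 0 s ≡ 1
cw[0,s]≡1 zero    = refl
cw[0,s]≡1 (suc s) = trans (+-identityʳ (cw 0 s)) (cw[0,s]≡1 s)

cw[1,s]≡1+s : ∀ s → cw 1 s ≡ suc s
cw[1,s]≡1+s zero    = refl
cw[1,s]≡1+s (suc s) = begin
  cw 1 s + (cw 0 (suc s) + 0) ≡⟨ cong₂ _+_ (cw[1,s]≡1+s s) (trans (+-identityʳ _) (cw[0,s]≡1 (suc s))) ⟩
  suc s + 1                   ≡⟨ +-comm (suc s) 1 ⟩
  suc (suc s)                 ∎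
  where open ≡-Reasoning

record CompositionRecurrence (f : ℕ → ℕ → ℕ) : Set where
  field
    initial  : ∀ s → f 0 s ≡ suc s
    boundary : ∀ n → f (suc n) 0 ≡ 2 * f n 0
    step     : ∀ n s → f (suc n) (suc s) + f n s ≡ 2 * f n (suc s) + f (suc n) s

CompositionRecurrence-unique : ∀ {f g} → CompositionRecurrence f → CompositionRecurrence g →
                               ∀ n s → f n s ≡ g n s
CompositionRecurrence-unique {f} {g} F G = unique
  where
  module F = CompositionRecurrence F
  module G = CompositionRecurrence G
  unique : ∀ n s → f n s ≡ g n s
  unique zero    s       = trans (F.initial s) (sym (G.initial s))
  unique (suc n) zero    = trans (F.boundary n) (trans (cong (2 *_) (unique n 0)) (sym (G.boundary n)))
  unique (suc n) (suc s) = +-cancelʳ-≡ (f n s) _ _ (begin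
    f (suc n) (suc s) + f n s             ≡⟨ F.step n s ⟩
    2 * f n (suc s) + f (suc n) s         ≡⟨ cong₂ (λ x y → 2 * x + y) (unique n (suc s)) (unique (suc n) s) ⟩
    2 * g n (suc s) + g (suc n) s         ≡⟨ G.step n s ⟨
    g (suc n) (suc s) + g n s             ≡⟨ cong (g (suc n) (suc s) +_) (unique n s) ⟨
    g (suc n) (suc s) + f n s             ∎)
    where open ≡-Reasoning

cw-recurrence : CompositionRecurrence (cw ∘ suc)
cw-recurrence = record
  { initial  = cw[1,s]≡1+s
  ; boundary = λ n → let x = cw (suc n) 0 in sym (cong (x +_) (+-identityʳ x))
  ; step     = λ n s → shuffle (cw (suc (suc n)) s) (cw (suc n) s) (cw⁺ (suc n) (suc s))
  }
  where
  shuffle : ∀ a c q → a + ((c + q) + q) + c ≡ 2 * (c + q) + a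
  shuffle = solve-∀

-- The coefficient of x^k in (2 + x)^n (1 + x)^m.
insets₂ : ℕ → ℕ → ℕ → ℕ
insets₂ m zero    k       = m C k
insets₂ m (suc n) zero    = 2 * insets₂ m n zero
insets₂ m (suc n) (suc k) = 2 * insets₂ m n (suc k) + insets₂ m n k

insets₂-suc-block : ∀ m n k → insets₂ (suc m) n k + insets₂ m n k ≡ insets₂ m (suc n) k
insets₂-suc-block m zero zero = refl
insets₂-suc-block m zero (suc k) = begin
  suc m C suc k + m C suc k         ≡⟨ cong (_+ m C suc k) (nCk+nC[k+1]≡[n+1]C[k+1] m k) ⟨
  (m C k + m C suc k) + m C suc k   ≡⟨ regroup (m C k) (m C suc k) ⟩
  2 * (m C suc k) + m C k           ∎
  where
  open ≡-Reasoning
  regroup : ∀ a b → (a + b) + b ≡ 2 * b + a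
  regroup = solve-∀
insets₂-suc-block m (suc n) zero =
  trans (sym (*-distribˡ-+ 2 (insets₂ (suc m) n 0) _)) (cong (2 *_) (insets₂-suc-block m n 0))
insets₂-suc-block m (suc n) (suc k) =
  trans (regroup (insets₂ (suc m) n (suc k)) (insets₂ (suc m) n k) (insets₂ m n (suc k)) (insets₂ m n k))
        (cong₂ (λ x y → 2 * x + y) (insets₂-suc-block m n (suc k)) (insets₂-suc-block m n k))
  where
  regroup : ∀ x′ y′ x y → (2 * x′ + y′) + (2 * x + y) ≡ 2 * (x′ + x) + (y′ + y)
  regroup = solve-∀

insets₂-recurrence : CompositionRecurrence (λ n s → insets₂ (suc s) n s)
insets₂-recurrence = record
  { initial  = λ s → trans (nCk≡nC[n∸k] (n≤1+n s)) (trans (cong (suc s C_) (m+n∸n≡m 1 s)) (nC1≡n (suc s)))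
  ; boundary = λ n → refl
  ; step     = λ n s → let x = 2 * insets₂ (suc (suc s)) n (suc s) in
      trans (+-assoc x _ _) (cong (x +_) (insets₂-suc-block (suc s) n s))
  }

count : (X → Bool) → List X → ℕ
count p xs = length (filterᵇ p xs)

count-++ : (p : X → Bool) (xs ys : List X) → count p (xs ++ ys) ≡ count p xs + count p ys
count-++ p xs ys = trans (cong length (filter-++ (T? ∘ p) xs ys)) (length-++ (filterᵇ p xs))

count-cong : {p q : X → Bool} → p ≗ q → (xs : List X) → count p xs ≡ count q xs
count-cong {p = p} {q = q} p≗q xs =
  cong length (filter-≐ (T? ∘ p) (T? ∘ q) ((λ {x} → subst T (p≗q x)) , (λ {x} → subst T (sym (p≗q x)))) xs)

count-none : {p : X → Bool} → (∀ x → ¬ T (p x)) → (xs : List X) → count p xs ≡ 0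
count-none {p = p} never xs = cong length (filter-none (T? ∘ p) (universal never xs))

count-map : (p : Y → Bool) (f : X → Y) (xs : List X) → count p (map f xs) ≡ count (p ∘ f) xs
count-map p f []       = refl
count-map p f (x ∷ xs) with p (f x)
... | true  = cong suc (count-map p f xs)
... | false = count-map p f xs

count-concatMap-map : (p : Z → Bool) (h : X → Y → Z) (xs : List X) (ys : List Y) →
  count p (concatMap (λ x → map (h x) ys) xs) ≡ sum (map (λ x → count (p ∘ h x) ys) xs)
count-concatMap-map p h []       ys = refl
count-concatMap-map p h (x ∷ xs) ys =
  trans (count-++ p (map (h x) ys) _) (cong₂ _+_ (count-map p (h x) ys) (count-concatMap-map p h xs ys))

cartesianProduct-mapˡ : (f : X → Y) (xs : List X) (ys : List Z) →
  cartesianProduct (map f xs) ys ≡ map (Product.map₁ f) (cartesianProduct xs ys)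
cartesianProduct-mapˡ f []       ys = refl
cartesianProduct-mapˡ f (x ∷ xs) ys = begin
  map (f x ,_) ys ++ cartesianProduct (map f xs) ys
    ≡⟨ cong (map (f x ,_) ys ++_) (cartesianProduct-mapˡ f xs ys) ⟩
  map (f x ,_) ys ++ map (Product.map₁ f) (cartesianProduct xs ys)
    ≡⟨ cong (_++ _) (map-∘ ys) ⟩
  map (Product.map₁ f) (map (x ,_) ys) ++ map (Product.map₁ f) (cartesianProduct xs ys)
    ≡⟨ map-++ (Product.map₁ f) (map (x ,_) ys) _ ⟨
  map (Product.map₁ f) (map (x ,_) ys ++ cartesianProduct xs ys)
    ∎
  where open ≡-Reasoning

cartesianProduct-concatMap-map : (h : X → Y → Z) (xs : List X) (ys : List Y) (zs : List W) →
  cartesianProduct (concatMap (λ x → map (h x) ys) xs) zs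
    ≡ concatMap (λ x → map (Product.map₁ (h x)) (cartesianProduct ys zs)) xs
cartesianProduct-concatMap-map h []       ys zs = refl
cartesianProduct-concatMap-map h (x ∷ xs) ys zs =
  trans (cartesianProductWith-distribʳ-++ _,_ (map (h x) ys) _ zs)
        (cong₂ _++_ (cartesianProduct-mapˡ (h x) ys zs) (cartesianProduct-concatMap-map h xs ys zs))

count-trues≡C : ∀ m k → count (λ a → trues a ≡ᵇ k) (allVecs allBools m) ≡ m C k
count-trues≡C zero    zero    = refl
count-trues≡C zero    (suc k) = refl
count-trues≡C (suc m) zero    =
  trans (count-concatMap-map _ _∷_ allBools (allVecs allBools m))
        (cong₂ _+_ (count-trues≡C m 0) (cong (_+ 0) (count-none (λ _ ()) (allVecs allBools m))))
count-trues≡C (suc m) (suc k) = begin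
  count (λ a → trues a ≡ᵇ suc k) (allVecs allBools (suc m))
    ≡⟨ count-concatMap-map _ _∷_ allBools (allVecs allBools m) ⟩
  count (λ a → trues a ≡ᵇ suc k) (allVecs allBools m) + (count (λ a → trues a ≡ᵇ k) (allVecs allBools m) + 0)
    ≡⟨ cong₂ _+_ (count-trues≡C m (suc k)) (trans (+-identityʳ _) (count-trues≡C m k)) ⟩
  m C suc k + m C k
    ≡⟨ +-comm (m C suc k) (m C k) ⟩
  m C k + m C suc k
    ≡⟨ nCk+nC[k+1]≡[n+1]C[k+1] m k ⟩
  suc m C suc k
    ∎
  where open ≡-Reasoning

anyTrue⇒1≤trues : ∀ {q} (v : Vec Bool q) → T (anyTrue v) → 1 ≤ trues v
anyTrue⇒1≤trues (true  ∷ v) _ = s≤s z≤n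
anyTrue⇒1≤trues (false ∷ v) t = anyTrue⇒1≤trues v t

allMet⇒n≤truesBlocks : ∀ {n q} (bs : Vec (Vec Bool q) n) → T (allMet bs) → n ≤ truesBlocks bs
allMet⇒n≤truesBlocks []       _ = z≤n
allMet⇒n≤truesBlocks (b ∷ bs) t =
  let met-b , met-bs = Equivalence.to T-∧ t in
  +-mono-≤ (anyTrue⇒1≤trues b met-b) (allMet⇒n≤truesBlocks bs met-bs)

allSubsetsX-suc : ∀ m n q → allSubsetsX m (suc n) q
  ≡ concatMap (λ b → map (Product.map₁ (b ∷_)) (allSubsetsX m n q)) (allVecs allBools q)
allSubsetsX-suc m n q =
  cartesianProduct-concatMap-map _∷_ (allVecs allBools q) (allVecs (allVecs allBools q) n) (allVecs allBools m)

full : Vec Bool 2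
full = true ∷ true ∷ []

containingFirstBlock : (m n k : ℕ) → ℕ
containingFirstBlock m n k = count (isInset m (suc n) k 2 ∘ Product.map₁ (full ∷_)) (allSubsetsX m n 2)

-- A first block met in exactly one of its two elements leaves an (n+k)-inset of the other blocks.
insetNum-suc : ∀ m n k → insetNum m (suc n) k 2 ≡ 2 * insetNum m n k 2 + containingFirstBlock m n k
insetNum-suc m n k = begin
  insetNum m (suc n) k 2
    ≡⟨ cong (count p) (allSubsetsX-suc m n 2) ⟩
  count p (concatMap (λ b → map (Product.map₁ (b ∷_)) (allSubsetsX m n 2)) (allVecs allBools 2))
    ≡⟨ count-concatMap-map p (λ b → Product.map₁ (b ∷_)) (allVecs allBools 2) (allSubsetsX m n 2) ⟩
  count (p ∘ Product.map₁ (empty ∷_)) (allSubsetsX m n 2) + (N + (N + (F + 0)))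
    ≡⟨ cong (_+ (N + (N + (F + 0)))) (count-none (λ _ t → proj₂ (Equivalence.to T-∧ t)) (allSubsetsX m n 2)) ⟩
  0 + (N + (N + (F + 0)))
    ≡⟨ regroup N F ⟩
  2 * N + F
    ∎
  where
  open ≡-Reasoning
  p = isInset m (suc n) k 2
  empty = false ∷ false ∷ []
  N = insetNum m n k 2
  F = containingFirstBlock m n k
  regroup : ∀ x y → 0 + (x + (x + (y + 0))) ≡ 2 * x + y
  regroup = solve-∀

containingFirstBlock-zero : ∀ m n → containingFirstBlock m n 0 ≡ 0
containingFirstBlock-zero m n = count-none too-small (allSubsetsX m n 2)
  where
  too-small : ∀ x → ¬ T (isInset m (suc n) 0 2 (Product.map₁ (full ∷_) x))
  too-small (bs , a) t =
    let size , met = Equivalence.to T-∧ t in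
    <-irrefl (trans (sym (+-identityʳ n)) (sym (≡ᵇ⇒≡ _ (n + 0) size)))
             (s≤s (≤-trans (allMet⇒n≤truesBlocks bs met) (m≤m+n (truesBlocks bs) (trues a))))

containingFirstBlock-suc : ∀ m n k → containingFirstBlock m n (suc k) ≡ insetNum m n k 2
containingFirstBlock-suc m n k =
  count-cong (λ { (bs , a) → cong (λ t → (suc (truesBlocks bs + trues a) ≡ᵇ t) ∧ allMet bs) (+-suc n k) })
             (allSubsetsX m n 2)

insetNum₂≡insets₂ : ∀ m n k → insetNum m n k 2 ≡ insets₂ m n k
insetNum₂≡insets₂ m zero k = begin
  count p (map ([] ,_) (allVecs allBools m) ++ [])           ≡⟨ count-++ p (map ([] ,_) (allVecs allBools m)) [] ⟩
  count p (map ([] ,_) (allVecs allBools m)) + 0             ≡⟨ +-identityʳ _ ⟩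
  count p (map ([] ,_) (allVecs allBools m))                 ≡⟨ count-map p ([] ,_) (allVecs allBools m) ⟩
  count (λ a → (trues a ≡ᵇ k) ∧ true) (allVecs allBools m)   ≡⟨ count-cong (λ a → ∧-identityʳ (trues a ≡ᵇ k)) (allVecs allBools m) ⟩
  count (λ a → trues a ≡ᵇ k) (allVecs allBools m)            ≡⟨ count-trues≡C m k ⟩
  m C k                                                      ∎
  where
  open ≡-Reasoning
  p = isInset m 0 k 2
insetNum₂≡insets₂ m (suc n) zero = begin
  insetNum m (suc n) 0 2                               ≡⟨ insetNum-suc m n 0 ⟩
  2 * insetNum m n 0 2 + containingFirstBlock m n 0   ≡⟨ cong₂ (λ x y → 2 * x + y) (insetNum₂≡insets₂ m n 0) (containingFirstBlock-zero m n) ⟩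
  2 * insets₂ m n 0 + 0                               ≡⟨ +-identityʳ _ ⟩
  2 * insets₂ m n 0                                   ∎
  where open ≡-Reasoning
insetNum₂≡insets₂ m (suc n) (suc k) = begin
  insetNum m (suc n) (suc k) 2                                 ≡⟨ insetNum-suc m n (suc k) ⟩
  2 * insetNum m n (suc k) 2 + containingFirstBlock m n (suc k) ≡⟨ cong (2 * insetNum m n (suc k) 2 +_) (containingFirstBlock-suc m n k) ⟩
  2 * insetNum m n (suc k) 2 + insetNum m n k 2                 ≡⟨ cong₂ (λ x y → 2 * x + y) (insetNum₂≡insets₂ m n (suc k)) (insetNum₂≡insets₂ m n k) ⟩
  2 * insets₂ m n (suc k) + insets₂ m n k                       ∎
  where open ≡-Reasoning

mainTheorem17 : (r s : ℕ) → 1 ≤ r → 1 ≤ s →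
    HasCard (WeakComp r s) (insetNum (suc s) (r ∸ 1) s 2)
mainTheorem17 (suc n) s _ _ = ↔⇒⤖ (subst (λ c → WeakComp (suc n) s ↔ Fin c) cw≡insetNum (WeakComp-cardinality (suc n) s))
  where
  cw≡insetNum : cw (suc n) s ≡ insetNum (suc s) n s 2
  cw≡insetNum = trans (CompositionRecurrence-unique cw-recurrence insets₂-recurrence n s)
                      (sym (insetNum₂≡insets₂ (suc s) n s))
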